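{- For every integer $r\ge1$, \[C_r(1-q)=\frac{1}{r+1}P_r(1^{r+1};q).\]
   Context: $q$ is an indeterminate. The Narayana numbers are $N(n,k)=\frac1n\binom{n}{k-1}\binom{n}{k}$, and the Narayana polynomials are $C_0(q)=1$ and $C_n(q)=\sum_{k=1}^n N(n,k)q^{k-1}$ for $n\ge1$. For an alphabet $x=(x_1,x_2,\ldots)$, the one-row Hall–Littlewood symmetric function is $P_0(x;q)=1$ and, for $r\ge1$, $P_r(x;q)=(1-q)^{ -1}g_r(x;q)$, where $\sum_{k\ge0}u^k g_k(x;q)=\prod_{i\ge1}\frac{1-qux_i}{1-ux_i}$. $P_r(1^{m};q)$ denotes the value of $P_r(x;q)$ at the $m$-vector $(1,\ldots,1)$. -}

module Defs where

open import Data.Nat as ℕ using (ℕ; zero; suc; _∸_)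
open import Data.Nat.Combinatorics using (_C_)
open import Data.Integer using (+_)
open import Data.List using (List; []; _∷_)
open import Data.Rational using (ℚ; 0ℚ; 1ℚ; _+_; _*_; -_; _/_)

sumTo : ℕ → (ℕ → ℚ) → ℚ
sumTo zero    f = 0ℚ
sumTo (suc n) f = sumTo n f + f n

-- Formal power series in the indeterminate q over ℚ:
-- a series is its coefficient function (k ↦ coefficient of q^k).
-- Polynomials in q are the series with finitely many nonzero coefficients;
-- equality is coefficientwise.

Series : Set
Series = ℕ → ℚ

constS : ℚ → Series
constS c zero    = c
constS c (suc _) = 0ℚ

qS : Series
qS 1 = 1ℚ
qS _ = 0ℚ

addS : Series → Series → Series
addS f g k = f k + g k

negS : Series → Series
negS f k = - f k

scaleS : ℚ → Series → Series
scaleS c f k = c * f k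

mulS : Series → Series → Series
mulS f g n = sumTo (suc n) (λ i → f i * g (n ∸ i))

powS : Series → ℕ → Series
powS f zero    = constS 1ℚ
powS f (suc m) = mulS (powS f m) f

sumS : ℕ → (ℕ → Series) → Series
sumS n F k = sumTo n (λ j → F j k)

oneMinusQ : Series
oneMinusQ = addS (constS 1ℚ) (negS qS)

-- (1 - q)^{-1} = Σ_k q^k  (the inverse of 1 - q in ℚ[[q]])
invOneMinusQ : Series
invOneMinusQ _ = 1ℚ

powQ : ℚ → ℕ → ℚ
powQ x zero    = 1ℚ
powQ x (suc k) = powQ x k * x

-- Narayana numbers N(n,k) = (1/n) binom(n,k-1) binom(n,k), for n ≥ 1
-- (written with n = suc m).

narayana : (m k : ℕ) → ℚ
narayana m k = (+ ((suc m C (k ∸ 1)) ℕ.* (suc m C k))) / suc m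

-- Narayana polynomial C_n evaluated at a series s:
-- C_0(s) = 1,  C_n(s) = Σ_{k=1}^{n} N(n,k) s^{k-1}.
narayanaPolyAt : ℕ → Series → Series
narayanaPolyAt zero    s = constS 1ℚ
narayanaPolyAt (suc m) s =
  sumS (suc m) (λ j → scaleS (narayana m (suc j)) (powS s j))

-- Power series in an auxiliary variable u with coefficients in ℚ[[q]]:
-- F n = coefficient of u^n.

BSeries : Set
BSeries = ℕ → Series

oneB : BSeries
oneB zero    = constS 1ℚ
oneB (suc _) = constS 0ℚ

mulB : BSeries → BSeries → BSeries
mulB F G n = sumS (suc n) (λ i → mulS (F i) (G (n ∸ i)))

-- the factor (1 - q u x) / (1 - u x) = (1 - q u x) · Σ_k (u x)^k
numFactor : ℚ → BSeries
numFactor x zero          = constS 1ℚ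
numFactor x (suc zero)    = scaleS (- x) qS
numFactor x (suc (suc _)) = constS 0ℚ

geomFactor : ℚ → BSeries
geomFactor x k = constS (powQ x k)

hlFactor : ℚ → BSeries
hlFactor x = mulB (numFactor x) (geomFactor x)

-- Π_i (1 - q u x_i)/(1 - u x_i) for a finite alphabet x
-- (variables beyond the list are 0 and contribute the factor 1)
hlProduct : List ℚ → BSeries
hlProduct []       = oneB
hlProduct (x ∷ xs) = mulB (hlFactor x) (hlProduct xs)

gHL : ℕ → List ℚ → Series
gHL r x = hlProduct x r

PHL : ℕ → List ℚ → Series
PHL zero    x = constS 1ℚ
PHL (suc r) x = mulS invOneMinusQ (gHL (suc r) x)

module Submission where

-- Put t = 1 - q.  At the alphabet 1^m each factor of the
-- generating function is  (1 - q u)/(1 - u) = 1 + t·(u + u² + …),  so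
--   ((1 - q u)/(1 - u))^m = Σ_i C(m,i) t^i (u/(1-u))^i ,
-- and the coefficient of u^n in (u/(1-u))^i is the number of compositions
-- of n into i positive parts, comp(n,i) = C(n-1,i-1).  Hence
--   g_n(1^m; q) = Σ_i C(m,i) comp(n,i) t^i .                          (★)
-- For m = r+1 = s+2 and n = r = s+1 the terms i = 0 and i = r+1 vanish,
-- every remaining term contains a factor t, and dividing by 1 - q gives
--   P_r(1^{r+1}; q) = Σ_{i ≤ s} C(s+2,i+1) C(s,i) t^i .
-- The theorem follows from  C(s+1,i) C(s+1,i+1)/(s+1) = C(s+2,i+1) C(s,i)/(s+2).

open import Defs
open import Data.Nat using (ℕ; zero; suc; _≤_; _<_; _∸_)
import Data.Nat as ℕ
import Data.Nat.Properties as ℕP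
open import Data.Nat.Combinatorics using (_C_; nC1≡n; k>n⇒nCk≡0; nCk+nC[k+1]≡[n+1]C[k+1])
open import Data.Integer using (+_)
import Data.Integer as ℤ
import Data.Integer.Properties as ℤP
open import Data.List using (replicate)
open import Data.Rational using (ℚ; 0ℚ; 1ℚ; _+_; _*_; -_; _/_; toℚᵘ)
import Data.Rational.Properties as ℚP
open import Data.Rational.Unnormalised as ℚᵘ using (mkℚᵘ; *≡*)
import Data.Rational.Unnormalised.Properties as ℚᵘP
import Data.Rational.Solver as ℚSolver
import Data.Nat.Solver as ℕSolver
import Data.Integer.Solver as ℤSolver
open import Relation.Binary.PropositionalEquality

sumTo-cong : ∀ n {f g : ℕ → ℚ} → (∀ i → i < n → f i ≡ g i) → sumTo n f ≡ sumTo n g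
sumTo-cong zero    eq = refl
sumTo-cong (suc n) eq =
  cong₂ _+_ (sumTo-cong n (λ i i<n → eq i (ℕP.m<n⇒m<1+n i<n))) (eq n ℕP.≤-refl)

sumTo-zero : ∀ n {f : ℕ → ℚ} → (∀ i → f i ≡ 0ℚ) → sumTo n f ≡ 0ℚ
sumTo-zero zero    eq = refl
sumTo-zero (suc n) eq = cong₂ _+_ (sumTo-zero n eq) (eq n)

sumTo-+ : ∀ n (f g : ℕ → ℚ) → sumTo n (λ i → f i + g i) ≡ sumTo n f + sumTo n g
sumTo-+ zero    f g = refl
sumTo-+ (suc n) f g = trans (cong (_+ (f n + g n)) (sumTo-+ n f g))
  (solve 4 (λ a b c d → (a :+ b) :+ (c :+ d) := (a :+ c) :+ (b :+ d)) refl
     (sumTo n f) (sumTo n g) (f n) (g n))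
  where open ℚSolver.+-*-Solver

sumTo-*ˡ : ∀ n c (f : ℕ → ℚ) → c * sumTo n f ≡ sumTo n (λ i → c * f i)
sumTo-*ˡ zero    c f = ℚP.*-zeroʳ c
sumTo-*ˡ (suc n) c f =
  trans (ℚP.*-distribˡ-+ c (sumTo n f) (f n)) (cong (_+ (c * f n)) (sumTo-*ˡ n c f))

sumTo-*ʳ : ∀ n c (f : ℕ → ℚ) → sumTo n f * c ≡ sumTo n (λ i → f i * c)
sumTo-*ʳ n c f = trans (ℚP.*-comm (sumTo n f) c)
  (trans (sumTo-*ˡ n c f) (sumTo-cong n (λ i _ → ℚP.*-comm c (f i))))

sumTo-shift : ∀ n (f : ℕ → ℚ) → sumTo (suc n) f ≡ f 0 + sumTo n (λ i → f (suc i))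
sumTo-shift zero    f = trans (ℚP.+-identityˡ (f 0)) (sym (ℚP.+-identityʳ (f 0)))
sumTo-shift (suc n) f = trans (cong (_+ f (suc n)) (sumTo-shift n f)) (ℚP.+-assoc (f 0) _ _)

sumTo-swap : ∀ n m (f : ℕ → ℕ → ℚ) →
  sumTo n (λ i → sumTo m (f i)) ≡ sumTo m (λ j → sumTo n (λ i → f i j))
sumTo-swap zero    m f = sym (sumTo-zero m (λ _ → refl))
sumTo-swap (suc n) m f = trans (cong (_+ sumTo m (f n)) (sumTo-swap n m f))
  (sym (sumTo-+ m (λ j → sumTo n (λ i → f i j)) (f n)))

sumTo-reverse : ∀ n (f : ℕ → ℚ) → sumTo n f ≡ sumTo n (λ i → f (n ∸ suc i))
sumTo-reverse zero    f = refl
sumTo-reverse (suc n) f = trans (cong (_+ f n) (sumTo-reverse n f))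
  (trans (ℚP.+-comm _ (f n)) (sym (sumTo-shift n (λ i → f (suc n ∸ suc i)))))

infix 4 _≈_
_≈_ : Series → Series → Set
f ≈ g = ∀ k → f k ≡ g k

mulS-congˡ : ∀ {f f′} g → f ≈ f′ → mulS f g ≈ mulS f′ g
mulS-congˡ g eq k = sumTo-cong (suc k) (λ i _ → cong (_* g (k ∸ i)) (eq i))

mulS-congʳ : ∀ f {g g′} → g ≈ g′ → mulS f g ≈ mulS f g′
mulS-congʳ f eq k = sumTo-cong (suc k) (λ i _ → cong (f i *_) (eq (k ∸ i)))

mulS-constˡ : ∀ c f → mulS (constS c) f ≈ scaleS c f
mulS-constˡ c f k = trans (sumTo-shift k _)
  (trans (cong (λ z → c * f k + z) (sumTo-zero k (λ i → ℚP.*-zeroˡ (f (k ∸ suc i)))))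
         (ℚP.+-identityʳ _))

mulS-comm : ∀ f g → mulS f g ≈ mulS g f
mulS-comm f g k = trans (sumTo-reverse (suc k) _)
  (sumTo-cong (suc k) (λ i i≤k →
    trans (cong (λ j → f (k ∸ i) * g j) (ℕP.m∸[m∸n]≡n (ℕP.≤-pred i≤k)))
          (ℚP.*-comm (f (k ∸ i)) (g i))))

mulS-sumʳ : ∀ f n (G : ℕ → Series) → mulS f (sumS n G) ≈ sumS n (λ j → mulS f (G j))
mulS-sumʳ f n G k =
  trans (sumTo-cong (suc k) (λ i _ → sumTo-*ˡ n (f i) (λ j → G j (k ∸ i))))
        (sumTo-swap (suc k) n (λ i j → f i * G j (k ∸ i)))

mulS-scaleʳ : ∀ f c g → mulS f (scaleS c g) ≈ scaleS c (mulS f g)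
mulS-scaleʳ f c g k =
  trans (sumTo-cong (suc k) (λ i _ →
          solve 3 (λ a b x → a :* (b :* x) := b :* (a :* x)) refl (f i) c (g (k ∸ i))))
        (sym (sumTo-*ˡ (suc k) c _))
  where open ℚSolver.+-*-Solver

t : Series
t = oneMinusQ

oneMinusQ-mul-zero : ∀ f → mulS t f 0 ≡ f 0
oneMinusQ-mul-zero f = trans (ℚP.+-identityˡ _) (ℚP.*-identityˡ (f 0))

oneMinusQ-mul-suc : ∀ f k → mulS t f (suc k) ≡ f (suc k) + - f k
oneMinusQ-mul-suc f k = begin
    sumTo (suc (suc k)) (λ i → t i * f (suc k ∸ i))
  ≡⟨ sumTo-shift (suc k) _ ⟩
    1ℚ * f (suc k) + sumTo (suc k) (λ i → t (suc i) * f (k ∸ i))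
  ≡⟨ cong (λ z → 1ℚ * f (suc k) + z) (sumTo-shift k _) ⟩
    1ℚ * f (suc k) + ((- 1ℚ) * f k + sumTo k (λ i → t (suc (suc i)) * f (k ∸ suc i)))
  ≡⟨ cong (λ z → 1ℚ * f (suc k) + ((- 1ℚ) * f k + z))
          (sumTo-zero k (λ i → ℚP.*-zeroˡ (f (k ∸ suc i)))) ⟩
    1ℚ * f (suc k) + ((- 1ℚ) * f k + 0ℚ)
  ≡⟨ solve 2 (λ a b → con 1ℚ :* a :+ ((:- con 1ℚ) :* b :+ con 0ℚ) := a :+ (:- b))
       refl (f (suc k)) (f k) ⟩
    f (suc k) + - f k
  ∎
  where
  open ≡-Reasoning
  open ℚSolver.+-*-Solver

-- hence the partial sums of (1 - q)·f telescope back to f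
oneMinusQ-mul-partialSum : ∀ f k → sumTo (suc k) (mulS t f) ≡ f k
oneMinusQ-mul-partialSum f zero    = trans (ℚP.+-identityˡ _) (oneMinusQ-mul-zero f)
oneMinusQ-mul-partialSum f (suc k) =
  trans (cong₂ _+_ (oneMinusQ-mul-partialSum f k) (oneMinusQ-mul-suc f k))
        (solve 2 (λ a b → b :+ (a :+ (:- b)) := a) refl (f (suc k)) (f k))
  where open ℚSolver.+-*-Solver

invOneMinusQ-cancel : ∀ f → mulS invOneMinusQ (mulS f t) ≈ f
invOneMinusQ-cancel f k =
  trans (sumTo-cong (suc k) (λ i _ → ℚP.*-identityˡ _))
  (trans (sym (sumTo-reverse (suc k) (mulS f t)))
  (trans (sumTo-cong (suc k) (λ i _ → mulS-comm f t i))
         (oneMinusQ-mul-partialSum f k)))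

fromℕ : ℕ → ℚ
fromℕ n = (+ n) / 1

-- as an unnormalised rational fromℕ n is n/1; the facts below are checked
-- in ℚᵘ and transported back along the injective map toℚᵘ
toℚᵘ-fromℕ : ∀ n → toℚᵘ (fromℕ n) ℚᵘ.≃ mkℚᵘ (+ n) 0
toℚᵘ-fromℕ n = ℚP.toℚᵘ-fromℚᵘ (mkℚᵘ (+ n) 0)

fromℕ-+ : ∀ a b → fromℕ (a ℕ.+ b) ≡ fromℕ a + fromℕ b
fromℕ-+ a b = ℚP.toℚᵘ-injective (ℚᵘP.≃-trans (toℚᵘ-fromℕ (a ℕ.+ b))
  (ℚᵘP.≃-trans sum≃ (ℚᵘP.≃-sym (ℚᵘP.≃-trans (ℚP.toℚᵘ-homo-+ (fromℕ a) (fromℕ b))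
     (ℚᵘP.+-cong (toℚᵘ-fromℕ a) (toℚᵘ-fromℕ b))))))
  where
  open ℤSolver.+-*-Solver
  sum≃ : mkℚᵘ (+ (a ℕ.+ b)) 0 ℚᵘ.≃ (mkℚᵘ (+ a) 0 ℚᵘ.+ mkℚᵘ (+ b) 0)
  sum≃ = *≡* (trans (cong (ℤ._* + 1) (ℤP.pos-+ a b))
    (solve 2 (λ x y → (x :+ y) :* con (+ 1) := (x :* con (+ 1) :+ y :* con (+ 1)) :* con (+ 1))
       refl (+ a) (+ b)))

fromℕ-* : ∀ a b → fromℕ (a ℕ.* b) ≡ fromℕ a * fromℕ b
fromℕ-* a b = ℚP.toℚᵘ-injective (ℚᵘP.≃-trans (toℚᵘ-fromℕ (a ℕ.* b))
  (ℚᵘP.≃-trans product≃ (ℚᵘP.≃-sym (ℚᵘP.≃-trans (ℚP.toℚᵘ-homo-* (fromℕ a) (fromℕ b))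
     (ℚᵘP.*-cong (toℚᵘ-fromℕ a) (toℚᵘ-fromℕ b))))))
  where
  product≃ : mkℚᵘ (+ (a ℕ.* b)) 0 ℚᵘ.≃ (mkℚᵘ (+ a) 0 ℚᵘ.* mkℚᵘ (+ b) 0)
  product≃ = *≡* (cong (ℤ._* + 1) (ℤP.pos-* a b))

fraction-rescale : ∀ a c d e → a ℕ.* suc e ≡ c ℕ.* suc d →
  (+ a) / suc d ≡ ((+ 1) / suc e) * fromℕ c
fraction-rescale a c d e eq = ℚP.toℚᵘ-injective
  (ℚᵘP.≃-trans (ℚP.toℚᵘ-fromℚᵘ (mkℚᵘ (+ a) d))
  (ℚᵘP.≃-trans cross≃ (ℚᵘP.≃-sym (ℚᵘP.≃-trans (ℚP.toℚᵘ-homo-* ((+ 1) / suc e) (fromℕ c))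
     (ℚᵘP.*-cong (ℚP.toℚᵘ-fromℚᵘ (mkℚᵘ (+ 1) e)) (toℚᵘ-fromℕ c))))))
  where
  cross≃ : mkℚᵘ (+ a) d ℚᵘ.≃ (mkℚᵘ (+ 1) e ℚᵘ.* mkℚᵘ (+ c) 0)
  cross≃ = *≡* (begin
      + a ℤ.* + (suc e ℕ.* 1)   ≡⟨ ℤP.pos-* a (suc e ℕ.* 1) ⟨
      + (a ℕ.* (suc e ℕ.* 1))   ≡⟨ cong (λ n → + (a ℕ.* n)) (ℕP.*-identityʳ (suc e)) ⟩
      + (a ℕ.* suc e)           ≡⟨ cong +_ eq ⟩
      + (c ℕ.* suc d)           ≡⟨ cong (λ n → + (n ℕ.* suc d)) (ℕP.+-identityʳ c) ⟨
      + ((1 ℕ.* c) ℕ.* suc d)   ≡⟨ ℤP.pos-* (1 ℕ.* c) (suc d) ⟩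
      + (1 ℕ.* c) ℤ.* + suc d   ≡⟨ cong (ℤ._* + suc d) (ℤP.pos-* 1 c) ⟩
      (+ 1 ℤ.* + c) ℤ.* + suc d ∎)
    where open ≡-Reasoning

-- Binomial coefficients

absorption : ∀ n i → suc i ℕ.* (suc n C suc i) ≡ suc n ℕ.* (n C i)
absorption zero    zero    = refl
absorption zero    (suc i) = ℕP.*-zeroʳ (suc (suc i))
absorption (suc n) zero    = begin
    1 ℕ.* (suc (suc n) C 1)   ≡⟨ ℕP.*-identityˡ _ ⟩
    suc (suc n) C 1           ≡⟨ nC1≡n (suc (suc n)) ⟩
    suc (suc n)               ≡⟨ ℕP.*-identityʳ (suc (suc n)) ⟨
    suc (suc n) ℕ.* 1         ∎
  where open ≡-Reasoning
absorption (suc n) (suc i) = begin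
    suc (suc i) ℕ.* (suc (suc n) C suc (suc i))
  ≡⟨ cong (suc (suc i) ℕ.*_) (sym (nCk+nC[k+1]≡[n+1]C[k+1] (suc n) (suc i))) ⟩
    suc (suc i) ℕ.* (X ℕ.+ Y)
  ≡⟨ solve 3 (λ i X Y → (con 2 :+ i) :* (X :+ Y) := X :+ (con 1 :+ i) :* X :+ (con 2 :+ i) :* Y)
       refl i X Y ⟩
    X ℕ.+ suc i ℕ.* X ℕ.+ suc (suc i) ℕ.* Y
  ≡⟨ cong₂ (λ u v → X ℕ.+ u ℕ.+ v) (absorption n i)
                                    (absorption n (suc i)) ⟩
    X ℕ.+ suc n ℕ.* (n C i) ℕ.+ suc n ℕ.* (n C suc i)
  ≡⟨ solve 4 (λ n X a b → X :+ (con 1 :+ n) :* a :+ (con 1 :+ n) :* b := X :+ (con 1 :+ n) :* (a :+ b))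
       refl n X (n C i) (n C suc i) ⟩
    X ℕ.+ suc n ℕ.* (n C i ℕ.+ n C suc i)
  ≡⟨ cong (λ z → X ℕ.+ suc n ℕ.* z) pascalX ⟩
    suc (suc n) ℕ.* X
  ∎
  where
  open ≡-Reasoning
  open ℕSolver.+-*-Solver
  X : ℕ
  X = suc n C suc i
  Y : ℕ
  Y = suc n C suc (suc i)
  pascalX : n C i ℕ.+ n C suc i ≡ X
  pascalX = nCk+nC[k+1]≡[n+1]C[k+1] n i

narayana-cross : ∀ s i →
  ((suc s C i) ℕ.* (suc s C suc i)) ℕ.* suc (suc s)
    ≡ ((suc (suc s) C suc i) ℕ.* (s C i)) ℕ.* suc s
narayana-cross s i = ℕP.*-cancelˡ-≡ _ _ (suc i) (begin
    suc i ℕ.* ((p ℕ.* q) ℕ.* suc (suc s))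
  ≡⟨ solve 4 (λ i p q s → (con 1 :+ i) :* ((p :* q) :* (con 2 :+ s))
                := p :* ((con 1 :+ i) :* q) :* (con 2 :+ s)) refl i p q s ⟩
    p ℕ.* (suc i ℕ.* q) ℕ.* suc (suc s)
  ≡⟨ cong (λ z → p ℕ.* z ℕ.* suc (suc s)) (absorption s i) ⟩
    p ℕ.* (suc s ℕ.* u) ℕ.* suc (suc s)
  ≡⟨ solve 3 (λ p u s → p :* ((con 1 :+ s) :* u) :* (con 2 :+ s)
                := ((con 2 :+ s) :* p) :* u :* (con 1 :+ s)) refl p u s ⟩
    (suc (suc s) ℕ.* p) ℕ.* u ℕ.* suc s
  ≡⟨ cong (λ z → z ℕ.* u ℕ.* suc s) (sym (absorption (suc s) i)) ⟩
    (suc i ℕ.* r) ℕ.* u ℕ.* suc s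
  ≡⟨ solve 4 (λ i r u s → ((con 1 :+ i) :* r) :* u :* (con 1 :+ s)
                := (con 1 :+ i) :* ((r :* u) :* (con 1 :+ s))) refl i r u s ⟩
    suc i ℕ.* ((r ℕ.* u) ℕ.* suc s)
  ∎)
  where
  open ≡-Reasoning
  open ℕSolver.+-*-Solver
  p : ℕ
  p = suc s C i
  q : ℕ
  q = suc s C suc i
  r : ℕ
  r = suc (suc s) C suc i
  u : ℕ
  u = s C i

narayana-binomial : ∀ s i →
  narayana s (suc i) ≡ ((+ 1) / suc (suc s)) * (fromℕ (suc (suc s) C suc i) * fromℕ (s C i))
narayana-binomial s i =
  trans (fraction-rescale ((suc s C i) ℕ.* (suc s C suc i)) ((suc (suc s) C suc i) ℕ.* (s C i))
                          s (suc s) (narayana-cross s i))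
        (cong (((+ 1) / suc (suc s)) *_) (fromℕ-* (suc (suc s) C suc i) (s C i)))

pascal-sum : ∀ m (g : ℕ → ℚ) →
  sumTo (suc (suc m)) (λ i → fromℕ (suc m C i) * g i)
    ≡ sumTo (suc m) (λ i → fromℕ (m C i) * g i) + sumTo (suc m) (λ i → fromℕ (m C i) * g (suc i))
pascal-sum m g = begin
    sumTo (suc (suc m)) (λ i → fromℕ (suc m C i) * g i)
  ≡⟨ sumTo-shift (suc m) _ ⟩
    1ℚ * g 0 + sumTo (suc m) (λ i → fromℕ (suc m C suc i) * g (suc i))
  ≡⟨ cong (λ z → 1ℚ * g 0 + z) (trans (sumTo-cong (suc m) (λ i _ → pascal i)) (sumTo-+ (suc m) _ _)) ⟩
    1ℚ * g 0 + (shifted + (tail + fromℕ (m C suc m) * g (suc m)))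
  ≡⟨ cong (λ z → 1ℚ * g 0 + (shifted + (tail + fromℕ z * g (suc m)))) (k>n⇒nCk≡0 (ℕP.n<1+n m)) ⟩
    1ℚ * g 0 + (shifted + (tail + 0ℚ * g (suc m)))
  ≡⟨ solve 4 (λ a b c x → con 1ℚ :* a :+ (b :+ (c :+ con 0ℚ :* x)) := (con 1ℚ :* a :+ c) :+ b)
       refl (g 0) shifted tail (g (suc m)) ⟩
    (1ℚ * g 0 + tail) + shifted
  ≡⟨ cong (_+ shifted) (sym (sumTo-shift m _)) ⟩
    sumTo (suc m) (λ i → fromℕ (m C i) * g i) + shifted
  ∎
  where
  open ≡-Reasoning
  open ℚSolver.+-*-Solver
  shifted : ℚ
  shifted = sumTo (suc m) (λ i → fromℕ (m C i) * g (suc i))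
  tail : ℚ
  tail = sumTo m (λ i → fromℕ (m C suc i) * g (suc i))
  pascal : ∀ i → fromℕ (suc m C suc i) * g (suc i)
                   ≡ fromℕ (m C i) * g (suc i) + fromℕ (m C suc i) * g (suc i)
  pascal i = trans (cong (λ n → fromℕ n * g (suc i)) (sym (nCk+nC[k+1]≡[n+1]C[k+1] m i)))
    (trans (cong (_* g (suc i)) (fromℕ-+ (m C i) (m C suc i)))
           (ℚP.*-distribʳ-+ (g (suc i)) (fromℕ (m C i)) (fromℕ (m C suc i))))

-- Compositions: comp(n,i) = number of ways to write n as an ordered sum
-- of i positive parts, i.e. C(n-1,i-1), with comp(0,0) = 1.  It is the
-- coefficient of u^n in (u/(1-u))^i.

compositions : ℕ → ℕ → ℕ
compositions zero    zero    = 1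
compositions zero    (suc i) = 0
compositions (suc n) zero    = 0
compositions (suc n) (suc i) = n C i

-- Pascal's rule for compositions (split on whether the last part is 1)
compositions-pascal : ∀ n i →
  compositions n (suc i) ℕ.+ compositions n i ≡ compositions (suc n) (suc i)
compositions-pascal zero    zero    = refl
compositions-pascal zero    (suc i) = refl
compositions-pascal (suc n) zero    = refl
compositions-pascal (suc n) (suc i) =
  trans (ℕP.+-comm (n C suc i) (n C i)) (nCk+nC[k+1]≡[n+1]C[k+1] n i)

-- hockey stick: Σ_{b < n} comp(b,i) = comp(n,i+1)  (sum over the last part)
hockey-stick : ∀ n i → sumTo n (λ b → fromℕ (compositions b i)) ≡ fromℕ (compositions n (suc i))
hockey-stick zero    i = refl
hockey-stick (suc n) i = begin
    sumTo n (λ b → fromℕ (compositions b i)) + fromℕ (compositions n i)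
  ≡⟨ cong (_+ fromℕ (compositions n i)) (hockey-stick n i) ⟩
    fromℕ (compositions n (suc i)) + fromℕ (compositions n i)
  ≡⟨ sym (fromℕ-+ (compositions n (suc i)) (compositions n i)) ⟩
    fromℕ (compositions n (suc i) ℕ.+ compositions n i)
  ≡⟨ cong fromℕ (compositions-pascal n i) ⟩
    fromℕ (compositions (suc n) (suc i))
  ∎
  where open ≡-Reasoning

-- The generating function at the alphabet 1^m

-- at x = 1 the factor (1 - q u)/(1 - u) is 1 + (1 - q)(u + u² + …)
geomFactor-one : ∀ j → geomFactor 1ℚ j ≈ constS 1ℚ
geomFactor-one j zero    = powQ-one j
  where
  powQ-one : ∀ j → powQ 1ℚ j ≡ 1ℚ
  powQ-one zero    = refl
  powQ-one (suc j) = cong (_* 1ℚ) (powQ-one j)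
geomFactor-one j (suc k) = refl

hlFactor-one-zero : hlFactor 1ℚ 0 ≈ constS 1ℚ
hlFactor-one-zero k = begin
    0ℚ + mulS (constS 1ℚ) (geomFactor 1ℚ 0) k   ≡⟨ ℚP.+-identityˡ _ ⟩
    mulS (constS 1ℚ) (geomFactor 1ℚ 0) k        ≡⟨ mulS-constˡ 1ℚ (geomFactor 1ℚ 0) k ⟩
    1ℚ * geomFactor 1ℚ 0 k                      ≡⟨ ℚP.*-identityˡ _ ⟩
    geomFactor 1ℚ 0 k                           ≡⟨ geomFactor-one 0 k ⟩
    constS 1ℚ k                                 ∎
  where open ≡-Reasoning

hlFactor-one-suc : ∀ a → hlFactor 1ℚ (suc a) ≈ t
hlFactor-one-suc a k = begin
    sumTo (suc (suc a)) F
  ≡⟨ sumTo-shift (suc a) F ⟩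
    F 0 + sumTo (suc a) (λ i → F (suc i))
  ≡⟨ cong (λ z → F 0 + z) (sumTo-shift a (λ i → F (suc i))) ⟩
    F 0 + (F 1 + sumTo a (λ i → F (suc (suc i))))
  ≡⟨ cong₂ _+_ term₀ (cong₂ _+_ term₁ (sumTo-zero a (λ i → higherTerms (a ∸ suc i)))) ⟩
    constS 1ℚ k + ((- 1ℚ) * qS k + 0ℚ)
  ≡⟨ solve 2 (λ x y → x :+ ((:- con 1ℚ) :* y :+ con 0ℚ) := x :+ (:- y)) refl (constS 1ℚ k) (qS k) ⟩
    t k
  ∎
  where
  open ≡-Reasoning
  open ℚSolver.+-*-Solver
  F : ℕ → ℚ
  F i = mulS (numFactor 1ℚ i) (geomFactor 1ℚ (suc a ∸ i)) k
  term₀ : F 0 ≡ constS 1ℚ k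
  term₀ = trans (mulS-constˡ 1ℚ (geomFactor 1ℚ (suc a)) k)
         (trans (ℚP.*-identityˡ _) (geomFactor-one (suc a) k))
  term₁ : F 1 ≡ (- 1ℚ) * qS k
  term₁ = begin
      mulS (numFactor 1ℚ 1) (geomFactor 1ℚ a) k ≡⟨ mulS-congʳ (numFactor 1ℚ 1) (geomFactor-one a) k ⟩
      mulS (numFactor 1ℚ 1) (constS 1ℚ) k       ≡⟨ mulS-comm (numFactor 1ℚ 1) (constS 1ℚ) k ⟩
      mulS (constS 1ℚ) (numFactor 1ℚ 1) k       ≡⟨ mulS-constˡ 1ℚ (numFactor 1ℚ 1) k ⟩
      1ℚ * numFactor 1ℚ 1 k                     ≡⟨ ℚP.*-identityˡ _ ⟩
      (- 1ℚ) * qS k                             ∎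
  higherTerms : ∀ j → mulS (constS 0ℚ) (geomFactor 1ℚ j) k ≡ 0ℚ
  higherTerms j = trans (mulS-constˡ 0ℚ (geomFactor 1ℚ j) k) (ℚP.*-zeroˡ (geomFactor 1ℚ j k))

hlPower : ℕ → BSeries
hlPower m = hlProduct (replicate m 1ℚ)

-- multiplying by 1 + (1 - q)(u + u² + …):
--   g_n(1^{m+1}) = g_n(1^m) + (1 - q) Σ_{b < n} g_b(1^m)
hlPower-step : ∀ m n → hlPower (suc m) n ≈ addS (hlPower m n) (mulS t (sumS n (hlPower m)))
hlPower-step m n k = begin
    sumTo (suc n) (λ a → mulS (hlFactor 1ℚ a) (hlPower m (n ∸ a)) k)
  ≡⟨ sumTo-shift n _ ⟩
    mulS (hlFactor 1ℚ 0) (hlPower m n) k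
      + sumTo n (λ a → mulS (hlFactor 1ℚ (suc a)) (hlPower m (n ∸ suc a)) k)
  ≡⟨ cong₂ _+_ (trans (mulS-congˡ (hlPower m n) hlFactor-one-zero k)
                      (trans (mulS-constˡ 1ℚ (hlPower m n) k) (ℚP.*-identityˡ (hlPower m n k))))
               (sumTo-cong n (λ a _ → mulS-congˡ (hlPower m (n ∸ suc a)) (hlFactor-one-suc a) k)) ⟩
    hlPower m n k + sumTo n (λ a → mulS t (hlPower m (n ∸ suc a)) k)
  ≡⟨ cong (λ z → hlPower m n k + z) (sym (sumTo-reverse n (λ b → mulS t (hlPower m b) k))) ⟩
    hlPower m n k + sumTo n (λ b → mulS t (hlPower m b) k)
  ≡⟨ cong (λ z → hlPower m n k + z) (sym (mulS-sumʳ t n (hlPower m) k)) ⟩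
    hlPower m n k + mulS t (sumS n (hlPower m)) k
  ∎
  where open ≡-Reasoning

-- The binomial expansion (★):  g_n(1^m; q) = Σ_{i ≤ m} C(m,i) comp(n,i) t^i

binomialPoly : ℕ → (ℕ → ℕ) → Series
binomialPoly m c = sumS (suc m) (λ i → scaleS (fromℕ (m C i)) (scaleS (fromℕ (c i)) (powS t i)))

hlExpansion : ℕ → ℕ → Series
hlExpansion m n = binomialPoly m (compositions n)

-- summing over n shifts the compositions index (hockey stick)
hlExpansion-partialSum : ∀ m n →
  sumS n (hlExpansion m) ≈ binomialPoly m (λ i → compositions n (suc i))
hlExpansion-partialSum m n k =
  trans (sumTo-swap n (suc m) (λ b i → fromℕ (m C i) * (fromℕ (compositions b i) * powS t i k)))
  (sumTo-cong (suc m) (λ i _ → begin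
      sumTo n (λ b → fromℕ (m C i) * (fromℕ (compositions b i) * powS t i k))
    ≡⟨ sym (sumTo-*ˡ n (fromℕ (m C i)) _) ⟩
      fromℕ (m C i) * sumTo n (λ b → fromℕ (compositions b i) * powS t i k)
    ≡⟨ cong (fromℕ (m C i) *_) (sym (sumTo-*ʳ n (powS t i k) _)) ⟩
      fromℕ (m C i) * (sumTo n (λ b → fromℕ (compositions b i)) * powS t i k)
    ≡⟨ cong (λ z → fromℕ (m C i) * (z * powS t i k)) (hockey-stick n i) ⟩
      fromℕ (m C i) * (fromℕ (compositions n (suc i)) * powS t i k)
    ∎))
  where open ≡-Reasoning

-- the expansion obeys the recurrence of hlPower-step (Pascal's rule)
hlExpansion-step : ∀ m n →
  hlExpansion (suc m) n ≈ addS (hlExpansion m n) (mulS t (sumS n (hlExpansion m)))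
hlExpansion-step m n k = begin
    sumTo (suc (suc m)) (λ i → fromℕ (suc m C i) * g i)
  ≡⟨ pascal-sum m g ⟩
    hlExpansion m n k + sumTo (suc m) (λ i → fromℕ (m C i) * g (suc i))
  ≡⟨ cong (λ z → hlExpansion m n k + z) (sym shifted) ⟩
    hlExpansion m n k + mulS t (sumS n (hlExpansion m)) k
  ∎
  where
  open ≡-Reasoning
  g : ℕ → ℚ
  g i = fromℕ (compositions n i) * powS t i k
  shiftedTerm : ℕ → Series
  shiftedTerm i = scaleS (fromℕ (compositions n (suc i))) (powS t i)
  shifted : mulS t (sumS n (hlExpansion m)) k ≡ sumTo (suc m) (λ i → fromℕ (m C i) * g (suc i))
  shifted =
    trans (mulS-congʳ t (hlExpansion-partialSum m n) k)
    (trans (mulS-sumʳ t (suc m) (λ i → scaleS (fromℕ (m C i)) (shiftedTerm i)) k)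
    (sumTo-cong (suc m) (λ i _ →
      trans (mulS-scaleʳ t (fromℕ (m C i)) (shiftedTerm i) k)
      (cong (fromℕ (m C i) *_)
        (trans (mulS-scaleʳ t (fromℕ (compositions n (suc i))) (powS t i) k)
               (cong (fromℕ (compositions n (suc i)) *_) (mulS-comm t (powS t i) k)))))))

hlPower-expansion : ∀ m n → hlPower m n ≈ hlExpansion m n
hlPower-expansion zero    zero    zero    = refl
hlPower-expansion zero    zero    (suc k) = refl
hlPower-expansion zero    (suc n) zero    = refl
hlPower-expansion zero    (suc n) (suc k) = refl
hlPower-expansion (suc m) n k =
  trans (hlPower-step m n k)
  (trans (cong₂ _+_ (hlPower-expansion m n k)
                    (mulS-congʳ t (λ k′ → sumTo-cong n (λ b _ → hlPower-expansion m b k′)) k))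
         (sym (hlExpansion-step m n k)))

binomialNarayana : ℕ → Series → Series
binomialNarayana s x =
  sumS (suc s) (λ i → scaleS (fromℕ (suc (suc s) C suc i)) (scaleS (fromℕ (s C i)) (powS x i)))

narayanaPoly-binomial : ∀ s x →
  narayanaPolyAt (suc s) x
    ≈ scaleS ((+ 1) / suc (suc s)) (binomialNarayana s x)
narayanaPoly-binomial s x k =
  trans (sumTo-cong (suc s) (λ i _ → term i)) (sym (sumTo-*ˡ (suc s) w _))
  where
  open ℚSolver.+-*-Solver
  w : ℚ
  w = (+ 1) / suc (suc s)
  term : ∀ i → narayana s (suc i) * powS x i k
               ≡ w * (fromℕ (suc (suc s) C suc i) * (fromℕ (s C i) * powS x i k))
  term i = trans (cong (_* powS x i k) (narayana-binomial s i))
    (solve 4 (λ w a b y → (w :* (a :* b)) :* y := w :* (a :* (b :* y))) refl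
       w (fromℕ (suc (suc s) C suc i)) (fromℕ (s C i)) (powS x i k))

-- in g_{s+1}(1^{s+2}) the terms i = 0 and i = s+2 vanish and 1 - q factors out
hlExpansion-diagonal : ∀ s →
  hlExpansion (suc (suc s)) (suc s)
    ≈ mulS (binomialNarayana s t) t
hlExpansion-diagonal s k = begin
    sumTo (suc (suc (suc s))) f
  ≡⟨ sumTo-shift (suc (suc s)) f ⟩
    f 0 + (S + f (suc (suc s)))
  ≡⟨ cong₂ (λ x y → x + (S + y)) first last ⟩
    0ℚ + (S + 0ℚ)
  ≡⟨ trans (ℚP.+-identityˡ _) (ℚP.+-identityʳ S) ⟩
    S
  ≡⟨ sym factorOut ⟩
    mulS (binomialNarayana s t) t k
  ∎
  where
  open ≡-Reasoning
  f : ℕ → ℚ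
  f i = fromℕ (suc (suc s) C i) * (fromℕ (compositions (suc s) i) * powS t i k)
  S : ℚ
  S = sumTo (suc s) (λ i → f (suc i))
  times-zero : ∀ a x → a * (0ℚ * x) ≡ 0ℚ
  times-zero a x = trans (cong (a *_) (ℚP.*-zeroˡ x)) (ℚP.*-zeroʳ a)
  -- comp(s+1, 0) = 0
  first : f 0 ≡ 0ℚ
  first = times-zero (fromℕ 1) (powS t 0 k)
  -- comp(s+1, s+2) = C(s, s+1) = 0
  last : f (suc (suc s)) ≡ 0ℚ
  last = trans (cong (λ z → fromℕ (suc (suc s) C suc (suc s)) * (fromℕ z * powS t (suc (suc s)) k))
                     (k>n⇒nCk≡0 (ℕP.n<1+n s)))
               (times-zero (fromℕ (suc (suc s) C suc (suc s))) (powS t (suc (suc s)) k))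
  factorOut : mulS (binomialNarayana s t) t k ≡ S
  factorOut =
    trans (mulS-comm (binomialNarayana s t) t k)
    (trans (mulS-sumʳ t (suc s)
             (λ i → scaleS (fromℕ (suc (suc s) C suc i)) (scaleS (fromℕ (s C i)) (powS t i))) k)
    (sumTo-cong (suc s) (λ i _ →
      trans (mulS-scaleʳ t (fromℕ (suc (suc s) C suc i)) (scaleS (fromℕ (s C i)) (powS t i)) k)
      (cong (fromℕ (suc (suc s) C suc i) *_)
        (trans (mulS-scaleʳ t (fromℕ (s C i)) (powS t i) k)
               (cong (fromℕ (s C i) *_) (mulS-comm t (powS t i) k)))))))

theorem2 : (r : ℕ) → 1 ≤ r → (k : ℕ) →
    narayanaPolyAt r oneMinusQ k
    ≡ scaleS ((+ 1) / suc r) (PHL r (replicate (suc r) 1ℚ)) k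
theorem2 zero    ()  k
theorem2 (suc s) _   k = sym (begin
    w * mulS invOneMinusQ (hlPower (suc (suc s)) (suc s)) k
  ≡⟨ cong (w *_) (mulS-congʳ invOneMinusQ
        (λ k′ → trans (hlPower-expansion (suc (suc s)) (suc s) k′) (hlExpansion-diagonal s k′)) k) ⟩
    w * mulS invOneMinusQ (mulS (binomialNarayana s t) t) k
  ≡⟨ cong (w *_) (invOneMinusQ-cancel (binomialNarayana s t) k) ⟩
    w * binomialNarayana s t k
  ≡⟨ sym (narayanaPoly-binomial s t k) ⟩
    narayanaPolyAt (suc s) t k
  ∎)
  where
  open ≡-Reasoning
  w : ℚ
  w = (+ 1) / suc (suc s)
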